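{- For every integer $k\ge 0$, the class of the counting function $\rho_{a_1^k}$ belongs to $U$.
   Context: $M_2$ is the free monoid over $\{a_1,a_2\}$; $\rho_u(w)$ counts the (possibly overlapping) occurrences of $u$ in $w$, and $\rho_\epsilon(w)=|w|$. Counting functions are finite linear combinations of the $\rho_u$ with coefficients in a fixed ring ($\mathbb Z,\mathbb Q,\mathbb R$ or $\mathbb C$); $\widehat C$ denotes the module of counting functions modulo bounded functions. It is known that $B=\{\rho_w : w\in M_2,\ w_1\ne a_1,\ w_{fin}\ne a_1\}$ (including $\rho_\epsilon$) is a basis of $\widehat C$. Let $B_U=\{\rho_\epsilon,\rho_{a_2}\}\cup\{\rho_{a_2a_1^ka_2}: k\ge 0\}\subset B$ and let $U$ be the span of $B_U$ in $\widehat C$. -}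

module Defs where

open import Data.Nat using (ℕ; zero; suc; _≤_)
open import Data.Integer using (ℤ; +_; _+_; _-_; _*_; ∣_∣)
open import Data.List using (List; []; _∷_; _++_; replicate)
open import Data.Bool using (Bool; true; false; _∧_; if_then_else_)
open import Data.Product using (Σ; ∃; _×_)

data Letter : Set where
  a₁ a₂ : Letter

Word : Set
Word = List Letter

_==_ : Letter → Letter → Bool
a₁ == a₁ = true
a₂ == a₂ = true
a₁ == a₂ = false
a₂ == a₁ = false

isPrefix : Word → Word → Bool
isPrefix [] w = true
isPrefix (x ∷ u) [] = false
isPrefix (x ∷ u) (y ∷ w) = (x == y) ∧ isPrefix u w

-- For u = ε this gives ρ ε w = |w|.
ρ : Word → Word → ℕ
ρ u [] = 0
ρ u (y ∷ w) = (if isPrefix u (y ∷ w) then 1 else 0) Data.Nat.+ ρ u w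

ρℤ : Word → Word → ℤ
ρℤ u w = + ρ u w

BoundedDiff : (Word → ℤ) → (Word → ℤ) → Set
BoundedDiff f g = ∃ λ (C : ℕ) → ∀ (w : Word) → ∣ f w - g w ∣ ≤ C

spanTail : ℕ → List ℤ → Word → ℤ
spanTail j [] w = + 0
spanTail j (c ∷ cs) w = c * ρℤ (a₂ ∷ (replicate j a₁ ++ (a₂ ∷ []))) w + spanTail (suc j) cs w

spanU : ℤ → ℤ → List ℤ → Word → ℤ
spanU c₀ c₁ cs w = c₀ * ρℤ [] w + c₁ * ρℤ (a₂ ∷ []) w + spanTail 0 cs w

-- The class of f in Ĉ (counting functions mod bounded functions) lies in U
InU : (Word → ℤ) → Set
InU f = Σ ℤ λ c₀ → Σ ℤ λ c₁ → Σ (List ℤ) λ cs → BoundedDiff f (spanU c₀ c₁ cs)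

-- Cut w into maximal runs of a₁.  A run a₁^L enclosed by two a₂'s contains L ∸ K = L − K + (K ∸ L)
-- occurrences of a₁^(K+1), and the enclosed runs of length L < K are counted by ρ (a₂ a₁^L a₂).
-- Since |w| counts the a₂'s as well, charging the −K of each run to the a₂ in front of it gives
--   ρ (a₁^(K+1)) w = |w| − (K+1)·ρ a₂ w + Σ_{L<K} (K − L)·ρ (a₂ a₁^L a₂) w
-- up to a correction for the first run (leadingA₁ w ⊓ K) and one for the last run
-- (trailingDeficit K w), both in [0, K].  With the corrections the identity is exact, and it is
-- proved by induction on w, one letter at a time.

module Submission where

open import Defs
open import Data.Nat using (ℕ; zero; suc; _+_; _*_; _∸_; _⊓_; _≤_; z≤n)
open import Data.Nat.Properties
  using (+-suc; +-comm; +-identityʳ; *-zeroʳ; *-identityˡ; ⊓-zeroʳ; 0∸n≡0; m∸n≤m; m⊓n≤n;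
         m⊓n+n∸m≡n; +-cancelʳ-≡; ⊔-lub; ≤-trans; ≤-reflexive)
open import Data.Nat.Tactic.RingSolver using (solve-∀)
open import Data.Integer as ℤ using (ℤ; -[1+_]; _⊖_; ∣_∣)
open import Data.Integer.Properties using (pos-+; pos-*; [+m]-[+n]≡m⊖n; ∣m⊝n∣≤m⊔n)
import Data.Integer.Tactic.RingSolver as ℤ-Solver
open import Data.List using (List; []; _∷_; _++_; replicate; length)
open import Data.List.Properties using (length-replicate)
open import Data.Bool using (Bool; true; false; if_then_else_)
open import Data.Product using (_,_)
open import Relation.Binary.PropositionalEquality
open ≡-Reasoning

headCount : Word → Word → ℕ
headCount u w = if isPrefix u w then 1 else 0

leadingA₁ : Word → ℕ
leadingA₁ []       = 0
leadingA₁ (a₁ ∷ w) = suc (leadingA₁ w)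
leadingA₁ (a₂ ∷ w) = 0

headCount-replicate-a₁ : ∀ K w →
  headCount (replicate K a₁) w + suc (leadingA₁ w) ⊓ K ≡ suc (leadingA₁ w ⊓ K)
headCount-replicate-a₁ zero    w        = cong suc (sym (⊓-zeroʳ (leadingA₁ w)))
headCount-replicate-a₁ (suc K) []       = refl
headCount-replicate-a₁ (suc K) (a₂ ∷ w) = refl
headCount-replicate-a₁ (suc K) (a₁ ∷ w) =
  trans (+-suc (headCount (replicate K a₁) w) _) (cong suc (headCount-replicate-a₁ K w))

onlyA₁ : Word → Bool
onlyA₁ []       = true
onlyA₁ (a₁ ∷ w) = onlyA₁ w
onlyA₁ (a₂ ∷ w) = false

trailingDeficit : ℕ → Word → ℕ
trailingDeficit K []       = 0
trailingDeficit K (a₁ ∷ w) = trailingDeficit K w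
trailingDeficit K (a₂ ∷ w) = if onlyA₁ w then K ∸ length w else trailingDeficit K w

trailingDeficit-≤ : ∀ K w → trailingDeficit K w ≤ K
trailingDeficit-≤ K []       = z≤n
trailingDeficit-≤ K (a₁ ∷ w) = trailingDeficit-≤ K w
trailingDeficit-≤ K (a₂ ∷ w) with onlyA₁ w
... | true  = m∸n≤m K (length w)
... | false = trailingDeficit-≤ K w

runThenA₂ : ℕ → Word
runThenA₂ j = replicate j a₁ ++ a₂ ∷ []

gapSum : ℕ → ℕ → Word → ℕ
gapSum j zero    w = 0
gapSum j (suc n) w = suc n * ρ (a₂ ∷ runThenA₂ j) w + gapSum (suc j) n w

-- The factor order makes a vanishing head count reduce definitionally (0 * suc n = 0).
gapSumAtHead : ℕ → ℕ → Word → ℕ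
gapSumAtHead j zero    w = 0
gapSumAtHead j (suc n) w = headCount (runThenA₂ j) w * suc n + gapSumAtHead (suc j) n w

gapSum-[] : ∀ j n → gapSum j n [] ≡ 0
gapSum-[] j zero    = refl
gapSum-[] j (suc n) = trans (cong (_+ gapSum (suc j) n []) (*-zeroʳ (suc n))) (gapSum-[] (suc j) n)

gapSum-a₁ : ∀ j n w → gapSum j n (a₁ ∷ w) ≡ gapSum j n w
gapSum-a₁ j zero    w = refl
gapSum-a₁ j (suc n) w = cong (suc n * ρ (a₂ ∷ runThenA₂ j) w +_) (gapSum-a₁ (suc j) n w)

gapSum-a₂ : ∀ j n w → gapSum j n (a₂ ∷ w) ≡ gapSumAtHead j n w + gapSum j n w
gapSum-a₂ j zero    w = refl
gapSum-a₂ j (suc n) w =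
  trans (cong (suc n * (h + r) +_) (gapSum-a₂ (suc j) n w)) (regroup (suc n) h r _ _)
  where
  h = headCount (runThenA₂ j) w
  r = ρ (a₂ ∷ runThenA₂ j) w
  regroup : ∀ s h r g t → s * (h + r) + (g + t) ≡ (h * s + g) + (s * r + t)
  regroup = solve-∀

gapSumAtHead-[] : ∀ j n → gapSumAtHead j n [] ≡ 0
gapSumAtHead-[] j       zero    = refl
gapSumAtHead-[] zero    (suc n) = gapSumAtHead-[] 1 n
gapSumAtHead-[] (suc j) (suc n) = gapSumAtHead-[] (suc (suc j)) n

gapSumAtHead-a₂ : ∀ j n w → gapSumAtHead (suc j) n (a₂ ∷ w) ≡ 0
gapSumAtHead-a₂ j zero    w = refl
gapSumAtHead-a₂ j (suc n) w = gapSumAtHead-a₂ (suc j) n w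

gapSumAtHead-a₁ : ∀ j n w → gapSumAtHead (suc j) n (a₁ ∷ w) ≡ gapSumAtHead j n w
gapSumAtHead-a₁ j zero    w = refl
gapSumAtHead-a₁ j (suc n) w =
  cong (headCount (runThenA₂ j) w * suc n +_) (gapSumAtHead-a₁ (suc j) n w)

gapSumAtHead-only : ∀ n L → gapSumAtHead 0 n (replicate L a₁) ≡ 0
gapSumAtHead-only zero    L       = refl
gapSumAtHead-only (suc n) zero    = gapSumAtHead-[] 0 (suc n)
gapSumAtHead-only (suc n) (suc L) = trans (gapSumAtHead-a₁ 0 n _) (gapSumAtHead-only n L)

gapSumAtHead-thenA₂ : ∀ n L v → gapSumAtHead 0 n (replicate L a₁ ++ a₂ ∷ v) ≡ n ∸ L
gapSumAtHead-thenA₂ zero    L       v = sym (0∸n≡0 L)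
gapSumAtHead-thenA₂ (suc n) zero    v =
  trans (cong₂ _+_ (*-identityˡ (suc n)) (gapSumAtHead-a₂ 0 n v)) (+-identityʳ (suc n))
gapSumAtHead-thenA₂ (suc n) (suc L) v = trans (gapSumAtHead-a₁ 0 n _) (gapSumAtHead-thenA₂ n L v)

data A₁Run : Word → Set where
  only   : ∀ L → A₁Run (replicate L a₁)
  thenA₂ : ∀ L v → A₁Run (replicate L a₁ ++ a₂ ∷ v)

a₁Run : ∀ w → A₁Run w
a₁Run []       = only 0
a₁Run (a₂ ∷ v) = thenA₂ 0 v
a₁Run (a₁ ∷ w) with a₁Run w
... | only L     = only (suc L)
... | thenA₂ L v = thenA₂ (suc L) v

leadingA₁-only : ∀ L → leadingA₁ (replicate L a₁) ≡ L
leadingA₁-only zero    = refl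
leadingA₁-only (suc L) = cong suc (leadingA₁-only L)

leadingA₁-thenA₂ : ∀ L v → leadingA₁ (replicate L a₁ ++ a₂ ∷ v) ≡ L
leadingA₁-thenA₂ zero    v = refl
leadingA₁-thenA₂ (suc L) v = cong suc (leadingA₁-thenA₂ L v)

onlyA₁-only : ∀ L → onlyA₁ (replicate L a₁) ≡ true
onlyA₁-only zero    = refl
onlyA₁-only (suc L) = onlyA₁-only L

onlyA₁-thenA₂ : ∀ L v → onlyA₁ (replicate L a₁ ++ a₂ ∷ v) ≡ false
onlyA₁-thenA₂ zero    v = refl
onlyA₁-thenA₂ (suc L) v = onlyA₁-thenA₂ L v

trailingDeficit-only : ∀ K L → trailingDeficit K (replicate L a₁) ≡ 0
trailingDeficit-only K zero    = refl
trailingDeficit-only K (suc L) = trailingDeficit-only K L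

m∸n+n⊓m≡m : ∀ m n → m ∸ n + n ⊓ m ≡ m
m∸n+n⊓m≡m m n = trans (+-comm (m ∸ n) (n ⊓ m)) (m⊓n+n∸m≡n n m)

trailingDeficit-a₂ : ∀ K w →
  K + trailingDeficit K w ≡ gapSumAtHead 0 K w + trailingDeficit K (a₂ ∷ w) + leadingA₁ w ⊓ K
trailingDeficit-a₂ K w with a₁Run w
... | only L
  rewrite trailingDeficit-only K L | gapSumAtHead-only K L | onlyA₁-only L
        | length-replicate L {a₁} | leadingA₁-only L
  = trans (+-identityʳ K) (sym (m∸n+n⊓m≡m K L))
... | thenA₂ L v
  rewrite gapSumAtHead-thenA₂ K L v | onlyA₁-thenA₂ L v | leadingA₁-thenA₂ L v
  = begin
    K + p                 ≡⟨ cong (_+ p) (sym (m∸n+n⊓m≡m K L)) ⟩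
    K ∸ L + L ⊓ K + p     ≡⟨ swap (K ∸ L) (L ⊓ K) p ⟩
    K ∸ L + p + L ⊓ K     ∎
  where
  p = trailingDeficit K (replicate L a₁ ++ a₂ ∷ v)
  swap : ∀ a b c → a + b + c ≡ a + c + b
  swap = solve-∀

module ExactIdentity (K : ℕ) where

  left right : Word → ℕ
  left  w = ρ (replicate (suc K) a₁) w + suc K * ρ (a₂ ∷ []) w + leadingA₁ w ⊓ K
  right w = ρ [] w + gapSum 0 K w + trailingDeficit K w

  left-a₁ : ∀ w → left (a₁ ∷ w) ≡ suc (left w)
  left-a₁ w = begin
    h + A + B + suc (leadingA₁ w) ⊓ K    ≡⟨ regroup h A B _ ⟩
    A + B + (h + suc (leadingA₁ w) ⊓ K)  ≡⟨ cong (A + B +_) (headCount-replicate-a₁ K w) ⟩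
    A + B + suc (leadingA₁ w ⊓ K)        ≡⟨ +-suc (A + B) _ ⟩
    suc (left w)                         ∎
    where
    h = headCount (replicate K a₁) w
    A = ρ (replicate (suc K) a₁) w
    B = suc K * ρ (a₂ ∷ []) w
    regroup : ∀ h a b m → h + a + b + m ≡ a + b + (h + m)
    regroup = solve-∀

  right-a₁ : ∀ w → right (a₁ ∷ w) ≡ suc (right w)
  right-a₁ w = cong (λ g → suc (ρ [] w) + g + trailingDeficit K w) (gapSum-a₁ 0 K w)

  left-a₂ : ∀ w → left (a₂ ∷ w) + leadingA₁ w ⊓ K ≡ suc K + left w
  left-a₂ w = regroup K (ρ (replicate (suc K) a₁) w) (ρ (a₂ ∷ []) w) _
    where
    regroup : ∀ k a b m → a + suc k * suc b + 0 + m ≡ suc k + (a + suc k * b + m)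
    regroup = solve-∀

  right-a₂ : ∀ w → right (a₂ ∷ w) + leadingA₁ w ⊓ K ≡ suc K + right w
  right-a₂ w = begin
    suc E + gapSum 0 K (a₂ ∷ w) + P′ + M  ≡⟨ cong (λ g → suc E + g + P′ + M) (gapSum-a₂ 0 K w) ⟩
    suc E + (G + T) + P′ + M             ≡⟨ regroup₁ E G T P′ M ⟩
    suc (E + T + (G + P′ + M))           ≡⟨ cong (λ x → suc (E + T + x)) (sym (trailingDeficit-a₂ K w)) ⟩
    suc (E + T + (K + P))                ≡⟨ regroup₂ E T K P ⟩
    suc K + right w                      ∎
    where
    E = ρ [] w
    G = gapSumAtHead 0 K w
    T = gapSum 0 K w
    P = trailingDeficit K w
    P′ = trailingDeficit K (a₂ ∷ w)
    M = leadingA₁ w ⊓ K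
    regroup₁ : ∀ e g t p m → suc e + (g + t) + p + m ≡ suc (e + t + (g + p + m))
    regroup₁ = solve-∀
    regroup₂ : ∀ e t k p → suc (e + t + (k + p)) ≡ suc k + (e + t + p)
    regroup₂ = solve-∀

  left≡right : ∀ w → left w ≡ right w
  left≡right [] = cong (_+ 0) (trans (*-zeroʳ K) (sym (gapSum-[] 0 K)))
  left≡right (a₁ ∷ w) = begin
    left (a₁ ∷ w)   ≡⟨ left-a₁ w ⟩
    suc (left w)    ≡⟨ cong suc (left≡right w) ⟩
    suc (right w)   ≡⟨ right-a₁ w ⟨
    right (a₁ ∷ w)  ∎
  left≡right (a₂ ∷ w) = +-cancelʳ-≡ _ _ _ (begin
    left (a₂ ∷ w) + leadingA₁ w ⊓ K   ≡⟨ left-a₂ w ⟩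
    suc K + left w                    ≡⟨ cong (suc K +_) (left≡right w) ⟩
    suc K + right w                   ≡⟨ right-a₂ w ⟨
    right (a₂ ∷ w) + leadingA₁ w ⊓ K  ∎)

descending : ℕ → List ℤ
descending zero    = []
descending (suc n) = ℤ.+ suc n ∷ descending n

spanTail-descending : ∀ j n w → spanTail j (descending n) w ≡ ℤ.+ gapSum j n w
spanTail-descending j zero    w = refl
spanTail-descending j (suc n) w = begin
  ℤ.+ suc n ℤ.* ℤ.+ r ℤ.+ spanTail (suc j) (descending n) w
    ≡⟨ cong₂ ℤ._+_ (sym (pos-* (suc n) r)) (spanTail-descending (suc j) n w) ⟩
  ℤ.+ (suc n * r) ℤ.+ ℤ.+ gapSum (suc j) n w
    ≡⟨ pos-+ (suc n * r) _ ⟨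
  ℤ.+ gapSum j (suc n) w
    ∎
  where r = ρ (a₂ ∷ runThenA₂ j) w

difference-of-identity : ∀ a s b m e t p → a ℤ.+ s ℤ.* b ℤ.+ m ≡ e ℤ.+ t ℤ.+ p →
  a ℤ.- (ℤ.+ 1 ℤ.* e ℤ.+ (ℤ.- s) ℤ.* b ℤ.+ t) ≡ p ℤ.- m
difference-of-identity a s b m e t p identity = begin
  a ℤ.- (ℤ.+ 1 ℤ.* e ℤ.+ (ℤ.- s) ℤ.* b ℤ.+ t)  ≡⟨ regroup a s b m e t ⟩
  a ℤ.+ s ℤ.* b ℤ.+ m ℤ.- (e ℤ.+ t) ℤ.- m       ≡⟨ cong (λ x → x ℤ.- (e ℤ.+ t) ℤ.- m) identity ⟩
  e ℤ.+ t ℤ.+ p ℤ.- (e ℤ.+ t) ℤ.- m            ≡⟨ cancel e t p m ⟩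
  p ℤ.- m                                      ∎
  where
  regroup : ∀ a s b m e t →
    a ℤ.- (ℤ.+ 1 ℤ.* e ℤ.+ (ℤ.- s) ℤ.* b ℤ.+ t) ≡ a ℤ.+ s ℤ.* b ℤ.+ m ℤ.- (e ℤ.+ t) ℤ.- m
  regroup = ℤ-Solver.solve-∀
  cancel : ∀ e t p m → e ℤ.+ t ℤ.+ p ℤ.- (e ℤ.+ t) ℤ.- m ≡ p ℤ.- m
  cancel = ℤ-Solver.solve-∀

approximation-error : ∀ K w →
  ρℤ (replicate (suc K) a₁) w ℤ.- spanU (ℤ.+ 1) -[1+ K ] (descending K) w
    ≡ trailingDeficit K w ⊖ leadingA₁ w ⊓ K
approximation-error K w = begin
  ℤ.+ A ℤ.- (ℤ.+ 1 ℤ.* ℤ.+ E ℤ.+ -[1+ K ] ℤ.* ℤ.+ B ℤ.+ spanTail 0 (descending K) w)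
    ≡⟨ cong (λ t → ℤ.+ A ℤ.- (ℤ.+ 1 ℤ.* ℤ.+ E ℤ.+ -[1+ K ] ℤ.* ℤ.+ B ℤ.+ t))
            (spanTail-descending 0 K w) ⟩
  ℤ.+ A ℤ.- (ℤ.+ 1 ℤ.* ℤ.+ E ℤ.+ -[1+ K ] ℤ.* ℤ.+ B ℤ.+ ℤ.+ T)
    ≡⟨ difference-of-identity (ℤ.+ A) (ℤ.+ suc K) (ℤ.+ B) (ℤ.+ M) (ℤ.+ E) (ℤ.+ T) (ℤ.+ P) exact ⟩
  ℤ.+ P ℤ.- ℤ.+ M
    ≡⟨ [+m]-[+n]≡m⊖n P M ⟩
  P ⊖ M
    ∎
  where
  open ExactIdentity K
  A = ρ (replicate (suc K) a₁) w
  B = ρ (a₂ ∷ []) w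
  M = leadingA₁ w ⊓ K
  E = ρ [] w
  T = gapSum 0 K w
  P = trailingDeficit K w
  exact : ℤ.+ A ℤ.+ ℤ.+ suc K ℤ.* ℤ.+ B ℤ.+ ℤ.+ M ≡ ℤ.+ E ℤ.+ ℤ.+ T ℤ.+ ℤ.+ P
  exact = begin
    ℤ.+ A ℤ.+ ℤ.+ suc K ℤ.* ℤ.+ B ℤ.+ ℤ.+ M
      ≡⟨ cong (λ x → ℤ.+ A ℤ.+ x ℤ.+ ℤ.+ M) (pos-* (suc K) B) ⟨
    ℤ.+ A ℤ.+ ℤ.+ (suc K * B) ℤ.+ ℤ.+ M
      ≡⟨ trans (cong (ℤ._+ ℤ.+ M) (pos-+ A _)) (pos-+ _ M) ⟨
    ℤ.+ left w
      ≡⟨ cong ℤ.+_ (left≡right w) ⟩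
    ℤ.+ right w
      ≡⟨ trans (pos-+ _ P) (cong (ℤ._+ ℤ.+ P) (pos-+ E T)) ⟩
    ℤ.+ E ℤ.+ ℤ.+ T ℤ.+ ℤ.+ P
      ∎

approximation-error-≤ : ∀ K w →
  ∣ ρℤ (replicate (suc K) a₁) w ℤ.- spanU (ℤ.+ 1) -[1+ K ] (descending K) w ∣ ≤ K
approximation-error-≤ K w rewrite approximation-error K w =
  ≤-trans (∣m⊝n∣≤m⊔n (trailingDeficit K w) (leadingA₁ w ⊓ K))
          (⊔-lub (trailingDeficit-≤ K w) (m⊓n≤n (leadingA₁ w) K))

lemma2p3 : ∀ (k : ℕ) → InU (λ w → ρℤ (replicate k a₁) w)
lemma2p3 zero    =
  ℤ.+ 1 , ℤ.+ 0 , [] , 0 , λ w → ≤-reflexive (cong ∣_∣ (length-exact (ρℤ [] w) (ρℤ (a₂ ∷ []) w)))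
  where
  length-exact : ∀ e b → e ℤ.- (ℤ.+ 1 ℤ.* e ℤ.+ ℤ.+ 0 ℤ.* b ℤ.+ ℤ.+ 0) ≡ ℤ.+ 0
  length-exact = ℤ-Solver.solve-∀
lemma2p3 (suc K) = ℤ.+ 1 , -[1+ K ] , descending K , K , approximation-error-≤ K
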